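{- Let $c,k$ be positive integers, $n=2kc$, and $G=Ci(n,\{c,2c,\dots,kc\})$. Then $G$ is closed distance magic.
   Context: For $S\subseteq\{1,\dots,\lfloor n/2\rfloor\}$, the circulant graph $Ci(n,S)$ has vertex set $\{v_0,\dots,v_{n-1}\}$, with $v_i$ adjacent to $v_j$ iff $|i-j|\in S$. A graph on $n$ vertices is closed distance magic if there is a bijection $\ell\colon V\to\{1,\dots,n\}$ and a positive integer $k'$ such that the sum of $\ell$ over the closed neighborhood $N[x]$ of every vertex $x$ equals $k'$. -}

module Defs where

open import Data.Nat using (ℕ; suc; _+_; _*_; _∸_; _≤_; _<_; _/_; ∣_-_∣)
open import Data.Nat.Properties using (_≟_)
open import Data.Fin using (Fin; toℕ)
open import Data.Fin.Properties using () renaming (_≟_ to _≟ᶠ_)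
open import Data.List using (List; []; _∷_; map; filter; upTo)
open import Data.Nat.ListAction using (sum)
open import Data.List.Membership.Propositional using (_∈_)
open import Data.List.Membership.DecPropositional _≟_ using (_∈?_)
open import Data.List.Relation.Unary.All using (All)
open import Data.Sum using (_⊎_)
open import Data.Product using (Σ; _×_)
open import Data.Vec.Functional using ()
open import Relation.Binary.PropositionalEquality using (_≡_)
open import Relation.Nullary using (Dec; _⊎-dec_)
open import Function.Bundles using (_⤖_; Bijection)
open import Data.List using () renaming (allFin to allFinL)

record Graph (n : ℕ) : Set₁ where
  field
    Adj  : Fin n → Fin n → Set
    adj? : (x y : Fin n) → Dec (Adj x y)

-- Circulant distance between vertices v_i and v_j of Ci(n,S):
-- the cyclic distance min(|i-j|, n-|i-j|); we test membership of
-- either |i-j| or n-|i-j| in S (equivalent since S ⊆ {1..⌊n/2⌋}).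
CirculantAdj : (n : ℕ) → List ℕ → Fin n → Fin n → Set
CirculantAdj n S i j = (∣ toℕ i - toℕ j ∣ ∈ S) ⊎ ((n ∸ ∣ toℕ i - toℕ j ∣) ∈ S)

Ci : (n : ℕ) → List ℕ → Graph n
Ci n S = record
  { Adj  = CirculantAdj n S
  ; adj? = λ i j → (∣ toℕ i - toℕ j ∣ ∈? S) ⊎-dec ((n ∸ ∣ toℕ i - toℕ j ∣) ∈? S) }

InClosedNbhd : ∀ {n} (G : Graph n) → Fin n → Fin n → Set
InClosedNbhd G x y = (y ≡ x) ⊎ Graph.Adj G x y

inClosedNbhd? : ∀ {n} (G : Graph n) (x y : Fin n) → Dec (InClosedNbhd G x y)
inClosedNbhd? G x y = (y ≟ᶠ x) ⊎-dec Graph.adj? G x y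

closedNbhdSum : ∀ {n} (G : Graph n) → (Fin n → ℕ) → Fin n → ℕ
closedNbhdSum G ℓ x = sum (map ℓ (filter (inClosedNbhd? G x) (allFinL _)))

label : ∀ {n} → Fin n ⤖ Fin n → Fin n → ℕ
label σ x = suc (toℕ (Bijection.to σ x))

ClosedDistanceMagic : ∀ {n} → Graph n → Set
ClosedDistanceMagic {n} G =
  Σ (Fin n ⤖ Fin n) λ σ →
  Σ ℕ λ k′ → (1 ≤ k′) × ((x : Fin n) → closedNbhdSum G (label σ) x ≡ k′)

multiples : ℕ → ℕ → List ℕ
multiples c k = map (λ i → suc i * c) (upTo k)

-- Write h = kc, so n = 2h. Every connection set element is a multiple of c, and conversely
-- every non-zero multiple of c below n is at circular distance at most kc; hence the closed
-- neighbourhood of a vertex is exactly its residue class mod c. That class contains k vertices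
-- z < h, and its other k vertices are their translates h + z. Labelling z ↦ z + 1 and
-- h + t ↦ 2h − t makes each pair {z, h + z} carry the label sum 2h + 1, so every closed
-- neighbourhood has label sum k(2h + 1).
module Submission where

open import Defs
open import Data.Nat using (ℕ; _*_; _≤_; zero; suc; _+_; _∸_; _<_; _%_; _/_; ∣_-_∣; z≤n; s≤s; s≤s⁻¹; z<s; NonZero; >-nonZero)
open import Data.Nat.Properties
open import Data.Nat.DivMod using (m≡m%n+[m/n]*n; m<n⇒m%n≡m; m%n<n; %-remove-+ˡ; %-remove-+ʳ)
open import Data.Nat.Divisibility using (_∣_; divides; ∣-refl; n∣m*n; ∣m∣n⇒∣m+n; ∣m+n∣m⇒∣n)
open import Data.Nat.ListAction using (sum)
open import Algebra.Properties.CommutativeSemigroup +-commutativeSemigroup using () renaming (interchange to +-interchange)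
open import Data.Nat.Tactic.RingSolver using (solve-∀)
open import Data.Fin as Fin using (Fin; toℕ; splitAt; join; opposite; _↑ˡ_; _↑ʳ_) renaming (_≟_ to _≟ᶠ_)
open import Data.Fin.Properties using (toℕ-↑ˡ; toℕ-↑ʳ; splitAt-join; join-splitAt; splitAt⁻¹-↑ˡ; splitAt⁻¹-↑ʳ; opposite-involutive; opposite-prop; toℕ-injective; toℕ<n)
open import Data.List using ([]; _∷_; map; filter; tabulate; allFin)
open import Data.List.Properties using (map-tabulate)
open import Data.List.Membership.Propositional using (_∈_)
open import Data.List.Membership.Propositional.Properties using (∈-map⁺; ∈-map⁻; ∈-upTo⁺)
open import Data.Sum using (_⊎_; inj₁; inj₂; map₂)
open import Data.Product using (_,_)
open import Data.Bool using (true; false; if_then_else_)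
open import Relation.Binary.PropositionalEquality
open import Relation.Nullary using (Dec; yes; no; does; contradiction)
open import Relation.Unary using (Pred; Decidable)
open import Function using (_∘_; id; _⇔_; mk⇔; Equivalence)
open import Function.Bundles using (_⤖_; mk↔ₛ′)
open import Function.Properties.Inverse using (↔⇒⤖)

∑< : ℕ → (ℕ → ℕ) → ℕ
∑< zero    f = 0
∑< (suc n) f = f 0 + ∑< n (f ∘ suc)

syntax ∑< n (λ z → e) = ∑[ z < n ] e

∑-cong : ∀ n {f g : ℕ → ℕ} → (∀ z → z < n → f z ≡ g z) → ∑< n f ≡ ∑< n g
∑-cong zero    f≗g = refl
∑-cong (suc n) f≗g = cong₂ _+_ (f≗g 0 z<s) (∑-cong n (λ z z<n → f≗g (suc z) (s≤s z<n)))

∑-zero : ∀ n → ∑[ _ < n ] 0 ≡ 0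
∑-zero zero    = refl
∑-zero (suc n) = ∑-zero n

∑-split : ∀ m n f → ∑< (m + n) f ≡ ∑< m f + ∑[ z < n ] f (m + z)
∑-split zero    n f = refl
∑-split (suc m) n f = trans (cong (f 0 +_) (∑-split m n (f ∘ suc))) (sym (+-assoc (f 0) _ _))

∑-distrib-+ : ∀ n f g → ∑[ z < n ] (f z + g z) ≡ ∑< n f + ∑< n g
∑-distrib-+ zero    f g = refl
∑-distrib-+ (suc n) f g =
  trans (cong ((f 0 + g 0) +_) (∑-distrib-+ n (f ∘ suc) (g ∘ suc))) (+-interchange (f 0) (g 0) _ _)

∑-*ʳ : ∀ n f a → ∑[ z < n ] (f z * a) ≡ ∑< n f * a
∑-*ʳ zero    f a = refl
∑-*ʳ (suc n) f a = trans (cong (f 0 * a +_) (∑-*ʳ n (f ∘ suc) a)) (sym (*-distribʳ-+ a (f 0) _))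

sum-map-allFin : ∀ n {f : Fin n → ℕ} (g : ℕ → ℕ) → (∀ i → f i ≡ g (toℕ i)) →
                 sum (map f (allFin n)) ≡ ∑< n g
sum-map-allFin n {f} g f≗g = trans (cong sum (map-tabulate id f)) (sum-tabulate n g f≗g)
  where
  sum-tabulate : ∀ n {f : Fin n → ℕ} (g : ℕ → ℕ) → (∀ i → f i ≡ g (toℕ i)) →
                 sum (tabulate f) ≡ ∑< n g
  sum-tabulate zero    g f≗g = refl
  sum-tabulate (suc n) g f≗g = cong₂ _+_ (f≗g Fin.zero) (sum-tabulate n (g ∘ suc) (f≗g ∘ Fin.suc))

𝟙 : ∀ {a} {A : Set a} → Dec A → ℕ
𝟙 a? = if does a? then 1 else 0

𝟙-cong : ∀ {a b} {A : Set a} {B : Set b} → A ⇔ B → (a? : Dec A) (b? : Dec B) → 𝟙 a? ≡ 𝟙 b?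
𝟙-cong A⇔B (yes _) (yes _) = refl
𝟙-cong A⇔B (no  _) (no  _) = refl
𝟙-cong A⇔B (yes a) (no ¬b) = contradiction (Equivalence.to A⇔B a) ¬b
𝟙-cong A⇔B (no ¬a) (yes b) = contradiction (Equivalence.from A⇔B b) ¬a

sum-map-filter : ∀ {a p} {A : Set a} {P : Pred A p} (P? : Decidable P) (f : A → ℕ) xs →
                 sum (map f (filter P? xs)) ≡ sum (map (λ x → 𝟙 (P? x) * f x) xs)
sum-map-filter P? f []       = refl
sum-map-filter P? f (x ∷ xs) with does (P? x)
... | true  = cong₂ _+_ (sym (+-identityʳ (f x))) (sum-map-filter P? f xs)
... | false = sum-map-filter P? f xs

∑-𝟙-≟ : ∀ {n r} → r < n → ∑[ z < n ] 𝟙 (z ≟ r) ≡ 1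
∑-𝟙-≟ {suc n} {zero}  _   = cong suc (∑-zero n)
∑-𝟙-≟ {suc n} {suc r} r<n = ∑-𝟙-≟ (s≤s⁻¹ r<n)

∑-𝟙-%≟ : ∀ {c r} .{{_ : NonZero c}} m → r < c → ∑[ z < m * c ] 𝟙 (z % c ≟ r) ≡ m
∑-𝟙-%≟         zero    _   = refl
∑-𝟙-%≟ {c} {r} (suc m) r<c = begin
  ∑[ z < c + m * c ] 𝟙 (z % c ≟ r)                                   ≡⟨ ∑-split c (m * c) _ ⟩
  ∑[ z < c ] 𝟙 (z % c ≟ r) + ∑[ z < m * c ] 𝟙 ((c + z) % c ≟ r)      ≡⟨ cong₂ _+_ firstPeriod laterPeriods ⟩
  suc m                                                               ∎
  where
  open ≡-Reasoning
  firstPeriod : ∑[ z < c ] 𝟙 (z % c ≟ r) ≡ 1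
  firstPeriod = trans (∑-cong c (λ z z<c → cong (λ u → 𝟙 (u ≟ r)) (m<n⇒m%n≡m z<c))) (∑-𝟙-≟ r<c)
  laterPeriods : ∑[ z < m * c ] 𝟙 ((c + z) % c ≟ r) ≡ m
  laterPeriods =
    trans (∑-cong (m * c) (λ z _ → cong (λ u → 𝟙 (u ≟ r)) (%-remove-+ˡ z ∣-refl))) (∑-𝟙-%≟ m r<c)

∣m-n∣<o : ∀ {m n o} → m < o → n < o → ∣ m - n ∣ < o
∣m-n∣<o {m} {n} m<o n<o = ≤-<-trans (∣m-n∣≤m⊔n m n) (⊔-lub m<o n<o)

∣n∣n∸o⇒∣o : ∀ {d n o} → o ≤ n → d ∣ n → d ∣ n ∸ o → d ∣ o
∣n∣n∸o⇒∣o o≤n d∣n d∣n∸o = ∣m+n∣m⇒∣n (subst (_ ∣_) (sym (m∸n+n≡m o≤n)) d∣n) d∣n∸o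

module _ {d : ℕ} .{{_ : NonZero d}} where

  m%d≡n%d⇒d∣n∸m : ∀ m n → m % d ≡ n % d → d ∣ n ∸ m
  m%d≡n%d⇒d∣n∸m m n eq = divides (n / d ∸ m / d) (begin
    n ∸ m                                         ≡⟨ cong₂ _∸_ (m≡m%n+[m/n]*n n d) (m≡m%n+[m/n]*n m d) ⟩
    (n % d + n / d * d) ∸ (m % d + m / d * d)     ≡⟨ cong (λ u → (n % d + n / d * d) ∸ (u + m / d * d)) eq ⟩
    (n % d + n / d * d) ∸ (n % d + m / d * d)     ≡⟨ [m+n]∸[m+o]≡n∸o (n % d) _ _ ⟩
    n / d * d ∸ m / d * d                         ≡⟨ *-distribʳ-∸ d (n / d) (m / d) ⟨
    (n / d ∸ m / d) * d                           ∎)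
    where open ≡-Reasoning

  d∣n∸m⇒n%d≡m%d : ∀ {m n} → m ≤ n → d ∣ n ∸ m → n % d ≡ m % d
  d∣n∸m⇒n%d≡m%d {m} m≤n d∣n∸m = trans (cong (_% d) (sym (m+[n∸m]≡n m≤n))) (%-remove-+ʳ m d∣n∸m)

  m%d≡n%d⇒d∣∣m-n∣ : ∀ m n → m % d ≡ n % d → d ∣ ∣ m - n ∣
  m%d≡n%d⇒d∣∣m-n∣ m n eq with ∣m-n∣≡[m∸n]∨[n∸m] m n
  ... | inj₁ e = subst (d ∣_) (sym e) (m%d≡n%d⇒d∣n∸m n m (sym eq))
  ... | inj₂ e = subst (d ∣_) (sym e) (m%d≡n%d⇒d∣n∸m m n eq)

  d∣∣m-n∣⇒m%d≡n%d : ∀ m n → d ∣ ∣ m - n ∣ → m % d ≡ n % d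
  d∣∣m-n∣⇒m%d≡n%d m n d∣ with ≤-total m n
  ... | inj₁ m≤n = sym (d∣n∸m⇒n%d≡m%d m≤n (subst (d ∣_) (m≤n⇒∣m-n∣≡n∸m m≤n) d∣))
  ... | inj₂ n≤m = d∣n∸m⇒n%d≡m%d n≤m (subst (d ∣_) (m≤n⇒∣n-m∣≡n∸m n≤m) d∣)

∈-multiples⁺ : ∀ {c k q} → 1 ≤ q → q ≤ k → q * c ∈ multiples c k
∈-multiples⁺ {c} {q = suc j} _ q≤k = ∈-map⁺ (λ i → suc i * c) (∈-upTo⁺ q≤k)

∈-multiples⁻ : ∀ {c k d} → d ∈ multiples c k → c ∣ d
∈-multiples⁻ d∈ with ∈-map⁻ _ d∈
... | i , _ , d≡[1+i]c = divides (suc i) d≡[1+i]c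

∈-multiples⊎complement : ∀ {c k d} → c ∣ d → 0 < d → d < k * c + k * c →
                         d ∈ multiples c k ⊎ (k * c + k * c) ∸ d ∈ multiples c k
∈-multiples⊎complement {c} {k} (divides zero    refl) ()
∈-multiples⊎complement {c} {k} (divides q@(suc _) refl) _ d<n with q ≤? k
... | yes q≤k = inj₁ (∈-multiples⁺ (s≤s z≤n) q≤k)
... | no  q≰k = inj₂ (subst (_∈ multiples c k) (sym complement) (∈-multiples⁺ (m<n⇒0<n∸m q<2k) 2k∸q≤k))
  where
  q<2k : q < k + k
  q<2k = *-cancelʳ-< c q (k + k) (subst (q * c <_) (sym (*-distribʳ-+ c k k)) d<n)
  2k∸q≤k : (k + k) ∸ q ≤ k
  2k∸q≤k = subst ((k + k) ∸ q ≤_) (m+n∸n≡m k k) (∸-monoʳ-≤ (k + k) (<⇒≤ (≰⇒> q≰k)))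
  complement : (k * c + k * c) ∸ q * c ≡ ((k + k) ∸ q) * c
  complement = trans (cong (_∸ q * c) (sym (*-distribʳ-+ c k k))) (sym (*-distribʳ-∸ c (k + k) q))

module Mirror (h : ℕ) where

  reflectUpper : Fin (h + h) → Fin (h + h)
  reflectUpper = join h h ∘ map₂ opposite ∘ splitAt h

  reflectUpper-involutive : ∀ y → reflectUpper (reflectUpper y) ≡ y
  reflectUpper-involutive y = begin
    join h h (map₂ opposite (splitAt h (join h h s′)))  ≡⟨ cong (join h h ∘ map₂ opposite) (splitAt-join h h s′) ⟩
    join h h (map₂ opposite s′)                          ≡⟨ cong (join h h) (map₂-opposite-involutive (splitAt h y)) ⟩
    join h h (splitAt h y)                               ≡⟨ join-splitAt h h y ⟩
    y                                                    ∎
    where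
    open ≡-Reasoning
    s′ = map₂ opposite (splitAt h y)
    map₂-opposite-involutive : ∀ (s : Fin h ⊎ Fin h) → map₂ opposite (map₂ opposite s) ≡ s
    map₂-opposite-involutive (inj₁ i) = refl
    map₂-opposite-involutive (inj₂ j) = cong inj₂ (opposite-involutive j)

  mirror : Fin (h + h) ⤖ Fin (h + h)
  mirror = ↔⇒⤖ (mk↔ₛ′ reflectUpper reflectUpper reflectUpper-involutive reflectUpper-involutive)

  -- For h ≤ z < 2h the upper clause equals 2h − (z − h).
  mirrorLabel : ℕ → ℕ
  mirrorLabel z with z <? h
  ... | yes _ = suc z
  ... | no  _ = suc (h + (h ∸ suc (z ∸ h)))

  mirrorLabel-lower : ∀ {z} → z < h → mirrorLabel z ≡ suc z
  mirrorLabel-lower {z} z<h with z <? h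
  ... | yes _   = refl
  ... | no  z≮h = contradiction z<h z≮h

  mirrorLabel-upper : ∀ t → mirrorLabel (h + t) ≡ suc (h + (h ∸ suc t))
  mirrorLabel-upper t with (h + t) <? h
  ... | yes h+t<h = contradiction h+t<h (≤⇒≯ (m≤m+n h t))
  ... | no  _     = cong (λ u → suc (h + (h ∸ suc u))) (m+n∸m≡n h t)

  label-mirror : ∀ y → label mirror y ≡ mirrorLabel (toℕ y)
  label-mirror y with splitAt h y in eq
  ... | inj₁ i = begin
    suc (toℕ (i ↑ˡ h))   ≡⟨ cong suc (toℕ-↑ˡ i h) ⟩
    suc (toℕ i)          ≡⟨ mirrorLabel-lower (toℕ<n i) ⟨
    mirrorLabel (toℕ i)  ≡⟨ cong mirrorLabel (trans (sym (toℕ-↑ˡ i h)) (cong toℕ (splitAt⁻¹-↑ˡ eq))) ⟩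
    mirrorLabel (toℕ y)  ∎
    where open ≡-Reasoning
  ... | inj₂ j = begin
    suc (toℕ (h ↑ʳ opposite j))    ≡⟨ cong suc (toℕ-↑ʳ h (opposite j)) ⟩
    suc (h + toℕ (opposite j))     ≡⟨ cong (λ u → suc (h + u)) (opposite-prop j) ⟩
    suc (h + (h ∸ suc (toℕ j)))    ≡⟨ mirrorLabel-upper (toℕ j) ⟨
    mirrorLabel (h + toℕ j)        ≡⟨ cong mirrorLabel (trans (sym (toℕ-↑ʳ h j)) (cong toℕ (splitAt⁻¹-↑ʳ eq))) ⟩
    mirrorLabel (toℕ y)            ∎
    where open ≡-Reasoning

  mirrorLabel-pair : ∀ {z} → z < h → mirrorLabel z + mirrorLabel (h + z) ≡ suc (h + h)
  mirrorLabel-pair {z} z<h = begin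
    mirrorLabel z + mirrorLabel (h + z)    ≡⟨ cong₂ _+_ (mirrorLabel-lower z<h) (mirrorLabel-upper z) ⟩
    suc z + suc (h + (h ∸ suc z))          ≡⟨ regroup z h (h ∸ suc z) ⟩
    suc (h + (suc z + (h ∸ suc z)))        ≡⟨ cong (λ u → suc (h + u)) (m+[n∸m]≡n z<h) ⟩
    suc (h + h)                            ∎
    where
    open ≡-Reasoning
    regroup : ∀ z h x → suc z + suc (h + x) ≡ suc (h + (suc z + x))
    regroup = solve-∀

  ∑-mirrorLabel : ∀ (w : ℕ → ℕ) → (∀ z → z < h → w (h + z) ≡ w z) →
                  ∑[ z < h + h ] (w z * mirrorLabel z) ≡ ∑< h w * suc (h + h)
  ∑-mirrorLabel w periodic = begin
    ∑[ z < h + h ] (w z * mirrorLabel z)                                      ≡⟨ ∑-split h h _ ⟩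
    ∑[ z < h ] (w z * mirrorLabel z) + ∑[ z < h ] (w (h + z) * mirrorLabel (h + z)) ≡⟨ ∑-distrib-+ h _ _ ⟨
    ∑[ z < h ] (w z * mirrorLabel z + w (h + z) * mirrorLabel (h + z))          ≡⟨ ∑-cong h pairUp ⟩
    ∑[ z < h ] (w z * suc (h + h))                                             ≡⟨ ∑-*ʳ h w (suc (h + h)) ⟩
    ∑< h w * suc (h + h)                                                       ∎
    where
    open ≡-Reasoning
    pairUp : ∀ z → z < h → w z * mirrorLabel z + w (h + z) * mirrorLabel (h + z) ≡ w z * suc (h + h)
    pairUp z z<h = begin
      w z * mirrorLabel z + w (h + z) * mirrorLabel (h + z)  ≡⟨ cong (λ u → w z * mirrorLabel z + u * mirrorLabel (h + z)) (periodic z z<h) ⟩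
      w z * mirrorLabel z + w z * mirrorLabel (h + z)        ≡⟨ *-distribˡ-+ (w z) _ _ ⟨
      w z * (mirrorLabel z + mirrorLabel (h + z))            ≡⟨ cong (w z *_) (mirrorLabel-pair z<h) ⟩
      w z * suc (h + h)                                      ∎

module CirculantOfMultiples (c k : ℕ) .{{_ : NonZero c}} where

  h : ℕ
  h = k * c

  G : Graph (h + h)
  G = Ci (h + h) (multiples c k)

  c∣h+h : c ∣ h + h
  c∣h+h = ∣m∣n⇒∣m+n (n∣m*n k) (n∣m*n k)

  inClosedNbhd⇒≡-mod : ∀ {x y} → InClosedNbhd G x y → toℕ y % c ≡ toℕ x % c
  inClosedNbhd⇒≡-mod (inj₁ refl) = refl
  inClosedNbhd⇒≡-mod {x} {y} (inj₂ (inj₁ d∈S)) =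
    sym (d∣∣m-n∣⇒m%d≡n%d (toℕ x) (toℕ y) (∈-multiples⁻ d∈S))
  inClosedNbhd⇒≡-mod {x} {y} (inj₂ (inj₂ n∸d∈S)) =
    sym (d∣∣m-n∣⇒m%d≡n%d (toℕ x) (toℕ y) (∣n∣n∸o⇒∣o d≤n c∣h+h (∈-multiples⁻ n∸d∈S)))
    where d≤n = <⇒≤ (∣m-n∣<o (toℕ<n x) (toℕ<n y))

  ≡-mod⇒inClosedNbhd : ∀ {x y} → toℕ y % c ≡ toℕ x % c → InClosedNbhd G x y
  ≡-mod⇒inClosedNbhd {x} {y} eq with y ≟ᶠ x
  ... | yes y≡x = inj₁ y≡x
  ... | no  y≢x = inj₂ (∈-multiples⊎complement
                          (m%d≡n%d⇒d∣∣m-n∣ (toℕ x) (toℕ y) (sym eq))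
                          (n≢0⇒n>0 (λ d≡0 → y≢x (toℕ-injective (sym (∣m-n∣≡0⇒m≡n d≡0)))))
                          (∣m-n∣<o (toℕ<n x) (toℕ<n y)))

  closedNbhd⇔≡-mod : ∀ x y → InClosedNbhd G x y ⇔ (toℕ y % c ≡ toℕ x % c)
  closedNbhd⇔≡-mod x y = mk⇔ inClosedNbhd⇒≡-mod ≡-mod⇒inClosedNbhd

  open Mirror h

  closedNbhdSum-mirror : ∀ x → closedNbhdSum G (label mirror) x ≡ k * suc (h + h)
  closedNbhdSum-mirror x = begin
    closedNbhdSum G (label mirror) x
      ≡⟨ sum-map-filter (inClosedNbhd? G x) (label mirror) (allFin (h + h)) ⟩
    sum (map (λ y → 𝟙 (inClosedNbhd? G x y) * label mirror y) (allFin (h + h)))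
      ≡⟨ sum-map-allFin (h + h) (λ z → w z * mirrorLabel z) summand ⟩
    ∑[ z < h + h ] (w z * mirrorLabel z)
      ≡⟨ ∑-mirrorLabel w (λ z _ → cong (λ u → 𝟙 (u ≟ r)) (%-remove-+ˡ z (n∣m*n k))) ⟩
    ∑< h w * suc (h + h)
      ≡⟨ cong (_* suc (h + h)) (∑-𝟙-%≟ k (m%n<n (toℕ x) c)) ⟩
    k * suc (h + h)
      ∎
    where
    open ≡-Reasoning
    r = toℕ x % c
    w : ℕ → ℕ
    w z = 𝟙 (z % c ≟ r)
    summand : ∀ y → 𝟙 (inClosedNbhd? G x y) * label mirror y ≡ w (toℕ y) * mirrorLabel (toℕ y)
    summand y = cong₂ _*_ (𝟙-cong (closedNbhd⇔≡-mod x y) (inClosedNbhd? G x y) (toℕ y % c ≟ r)) (label-mirror y)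

  closedDistanceMagic : 1 ≤ k → ClosedDistanceMagic G
  closedDistanceMagic 1≤k = mirror , k * suc (h + h) , *-mono-≤ 1≤k (s≤s z≤n) , closedNbhdSum-mirror

mainTheorem17 : (c k : ℕ) → 1 ≤ c → 1 ≤ k →
    ClosedDistanceMagic (Ci (2 * k * c) (multiples c k))
mainTheorem17 c k 1≤c 1≤k =
  subst (λ n → ClosedDistanceMagic (Ci n (multiples c k))) (sym (2kc≡kc+kc k c))
        (CirculantOfMultiples.closedDistanceMagic c k 1≤k)
  where
  instance
    c≢0 : NonZero c
    c≢0 = >-nonZero 1≤c
  2kc≡kc+kc : ∀ k c → 2 * k * c ≡ k * c + k * c
  2kc≡kc+kc = solve-∀
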